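{- If $u$ is a sequence with $r$ distinct letters, then for every positive integer $s$: every binary $(r, s)$-formation contains $u$ if and only if $s \geq \mathit{fw}(u)$.
   Context: A sequence $s$ contains a sequence $u$ if some subsequence of $s$ can be changed into $u$ by a one-to-one renaming of its letters. An $(r,s)$-formation is a concatenation of $s$ permutations of the same set of $r$ distinct letters; it is binary if there is a permutation $p$ of its letters such that every permutation in it is either $p$ or the reverse of $p$. The formation width $\mathit{fw}(u)$ is the minimum $s$ such that there exists $r'$ for which every $(r',s)$-formation contains $u$. -}

module Defs where

open import Data.Nat using (ℕ; _≤_; _≟_)
open import Data.List using (List; length; concat; reverse; deduplicate)
open import Data.List.Relation.Unary.All using (All)
open import Data.List.Relation.Unary.Unique.Propositional using (Unique)
open import Data.List.Relation.Binary.Sublist.Propositional using (_⊆_)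
open import Data.List.Relation.Binary.Permutation.Propositional using (_↭_)
open import Data.List.Membership.Propositional using (_∈_)
open import Data.List using (map)
open import Data.Product using (Σ; ∃; _×_)
open import Data.Sum using (_⊎_)
open import Relation.Binary.PropositionalEquality using (_≡_)

Seq : Set
Seq = List ℕ

distinctLetters : Seq → ℕ
distinctLetters u = length (deduplicate _≟_ u)

Contains : Seq → Seq → Set
Contains s u = Σ Seq λ v → v ⊆ s × Σ (ℕ → ℕ) λ f →
  (∀ {x y} → x ∈ v → y ∈ v → f x ≡ f y → x ≡ y) × map f v ≡ u

IsFormation : ℕ → ℕ → Seq → Set
IsFormation r s x = Σ (List Seq) λ ps → length ps ≡ s × concat ps ≡ x ×
  Σ Seq λ L → Unique L × length L ≡ r × All (λ q → q ↭ L) ps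

IsBinaryFormation : ℕ → ℕ → Seq → Set
IsBinaryFormation r s x = Σ (List Seq) λ ps → length ps ≡ s × concat ps ≡ x ×
  Σ Seq λ p → Unique p × length p ≡ r × All (λ q → q ≡ p ⊎ q ≡ reverse p) ps

FwWitness : Seq → ℕ → Set
FwWitness u s = ∃ λ r' → ∀ x → IsFormation r' s x → Contains x u

IsFormationWidth : Seq → ℕ → Set
IsFormationWidth u w = FwWitness u w × (∀ s → FwWitness u s → w ≤ s)

-- Forward direction: by Erdős–Szekeres, a permutation of a large set, compared with any other
-- permutation of it, has a long subsequence occurring there in the same or in the reversed
-- order. Applying this once per block shrinks the alphabet of a large (r', s)-formation to r
-- letters on which every block reads p or reverse p; so if all binary (r, s)-formations contain
-- u, so do all large (r', s)-formations, and fw(u) ≤ s.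
-- Backward direction: write a binary formation as a word in the orientations of p and keep its
-- first fw(u) blocks. The same orientation word over a large alphabet is an (r', fw(u))-formation,
-- hence contains u; the occurrence uses at most r letters of that alphabet, and renaming those
-- letters into p transports it into the binary formation.
module Submission where

open import Defs
open import Data.Bool using (Bool; true; false)
open import Data.Empty using (⊥-elim)
open import Data.List using (List; []; _∷_; _++_; [_]; length; concat; reverse; deduplicate; map; filter; take; upTo)
open import Data.List.Properties using (length-map; length-take; length-upTo; map-++; map-∘; map-cong-local; reverse-map; unfold-reverse; filter-++; filter-all; filter-accept; filter-reject; ++-identityʳ)
open import Data.List.Membership.Propositional using (_∈_)
open import Data.List.Membership.Propositional.Properties using (∈-map⁻; ∈-map⁺; ∈-deduplicate⁺; ∈-∃++; ∈-++⁻; ∈-++⁺ˡ; ∈-++⁺ʳ; ∈-filter⁻; ∈-concat⁻′)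
import Data.List.Membership.DecPropositional as DecMembership
open import Data.List.Relation.Binary.Subset.Propositional using () renaming (_⊆_ to _⊆ˢ_)
open import Data.List.Relation.Binary.Subset.Propositional.Properties using (⊆-reflexive-↭)
open import Data.List.Relation.Binary.Sublist.Propositional using (_⊆_; []; _∷_; _∷ʳ_; minimum; ⊆-trans)
open import Data.List.Relation.Binary.Sublist.Propositional.Properties using (All-resp-⊆; Any-resp-⊆; ++⁺; ++⁺ˡ; ++⁺ʳ; reverse⁺; map⁺; filter⁺; filter-⊆; take-⊆)
open import Data.List.Relation.Binary.Permutation.Propositional using (_↭_; ↭-refl; ↭-sym)
open import Data.List.Relation.Binary.Permutation.Propositional.Properties using (↭-reverse; ↭-length; shift; ∈-resp-↭)
open import Data.List.Relation.Unary.All as All using (All; []; _∷_)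
open import Data.List.Relation.Unary.All.Properties using () renaming (map⁺ to All-map⁺)
open import Data.List.Relation.Unary.AllPairs using ([]; _∷_)
open import Data.List.Relation.Unary.Any using (here; there)
open import Data.List.Relation.Unary.Unique.Propositional using (Unique)
open import Data.List.Relation.Unary.Unique.Propositional.Properties using (upTo⁺) renaming (filter⁺ to Unique-filter⁺; take⁺ to Unique-take⁺)
open import Data.Nat using (ℕ; zero; suc; pred; _+_; _≤_; _≤?_; _≟_; s≤s; z≤n)
open import Data.Nat.Properties using (module ≤-Reasoning; ≤-trans; ≤-reflexive; +-suc; +-monoˡ-≤; +-cancelˡ-≤; m≤n⇒m⊓n≡m; ≰⇒>; <⇒≤)
open import Data.Product using (∃₂; ∃-syntax; _×_; _,_)
open import Data.Sum using (_⊎_; inj₁; inj₂)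
open import Function using (_∘_)
open import Level using (Level)
open import Function.Bundles using (_⇔_; mk⇔)
open import Relation.Binary.Definitions using (DecidableEquality)
open import Relation.Binary.PropositionalEquality using (_≡_; refl; sym; trans; cong; cong₂; subst; subst₂; module ≡-Reasoning)
open import Relation.Nullary using (¬_; yes; no)
open import Relation.Unary using (Pred; Decidable)
open import Relation.Unary.Properties using (∁?)

private
  variable
    ℓ : Level
    A B : Set

+-≤-split : ∀ m n k l → m + n ≤ k + l → m ≤ k ⊎ n ≤ l
+-≤-split m n k l m+n≤k+l with m ≤? k
... | yes m≤k = inj₁ m≤k
... | no m≰k = inj₂ (+-cancelˡ-≤ k n l (≤-trans (+-monoˡ-≤ n (<⇒≤ (≰⇒> m≰k))) m+n≤k+l))

length-take-≤ : ∀ n (xs : List A) → n ≤ length xs → length (take n xs) ≡ n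
length-take-≤ n xs n≤ = trans (length-take n xs) (m≤n⇒m⊓n≡m n≤)

length-filter-∁ : {P : Pred A ℓ} (P? : Decidable P) (xs : List A) →
                  length (filter P? xs) + length (filter (∁? P?) xs) ≡ length xs
length-filter-∁ P? [] = refl
length-filter-∁ P? (x ∷ xs) with P? x
... | yes _ = cong suc (length-filter-∁ P? xs)
... | no _ = trans (+-suc _ _) (cong suc (length-filter-∁ P? xs))

filter-reverse : {P : Pred A ℓ} (P? : Decidable P) (xs : List A) →
                 filter P? (reverse xs) ≡ reverse (filter P? xs)
filter-reverse P? [] = refl
filter-reverse P? (x ∷ xs) = begin
  filter P? (reverse (x ∷ xs))          ≡⟨ cong (filter P?) (unfold-reverse x xs) ⟩
  filter P? (reverse xs ++ [ x ])       ≡⟨ filter-++ P? (reverse xs) [ x ] ⟩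
  filter P? (reverse xs) ++ filter P? [ x ] ≡⟨ cong (_++ filter P? [ x ]) (filter-reverse P? xs) ⟩
  reverse (filter P? xs) ++ filter P? [ x ] ≡⟨ last-step (P? x) ⟩
  reverse (filter P? (x ∷ xs))          ∎
  where
  open ≡-Reasoning
  last-step : _ → reverse (filter P? xs) ++ filter P? [ x ] ≡ reverse (filter P? (x ∷ xs))
  last-step (yes px) = begin
    reverse (filter P? xs) ++ filter P? [ x ] ≡⟨ cong (reverse (filter P? xs) ++_) (filter-accept P? px) ⟩
    reverse (filter P? xs) ++ [ x ]           ≡⟨ sym (unfold-reverse x (filter P? xs)) ⟩
    reverse (x ∷ filter P? xs)                ≡⟨ cong reverse (sym (filter-accept P? px)) ⟩
    reverse (filter P? (x ∷ xs))              ∎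
  last-step (no ¬px) = begin
    reverse (filter P? xs) ++ filter P? [ x ] ≡⟨ cong (reverse (filter P? xs) ++_) (filter-reject P? ¬px) ⟩
    reverse (filter P? xs) ++ []              ≡⟨ ++-identityʳ _ ⟩
    reverse (filter P? xs)                    ≡⟨ cong reverse (sym (filter-reject P? ¬px)) ⟩
    reverse (filter P? (x ∷ xs))              ∎

Unique-resp-⊆ : {xs ys : List A} → xs ⊆ ys → Unique ys → Unique xs
Unique-resp-⊆ [] [] = []
Unique-resp-⊆ (y ∷ʳ τ) (_ ∷ u) = Unique-resp-⊆ τ u
Unique-resp-⊆ (refl ∷ τ) (x∉ ∷ u) = All-resp-⊆ τ x∉ ∷ Unique-resp-⊆ τ u

InjectiveOn : (A → B) → List A → Set
InjectiveOn f xs = ∀ {x y} → x ∈ xs → y ∈ xs → f x ≡ f y → x ≡ y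

Unique-map⁺ : (f : A → B) {xs : List A} → InjectiveOn f xs → Unique xs → Unique (map f xs)
Unique-map⁺ f inj [] = []
Unique-map⁺ f inj (x∉ ∷ u) = fresh x∉ (inj (here refl) ∘ there) ∷ Unique-map⁺ f (λ a b → inj (there a) (there b)) u
  where
  fresh : ∀ {x zs} → All (λ z → ¬ x ≡ z) zs → (∀ {z} → z ∈ zs → f x ≡ f z → x ≡ z) →
          All (λ z → ¬ f x ≡ z) (map f zs)
  fresh [] _ = []
  fresh (x≢z ∷ x∉) inj = (x≢z ∘ inj (here refl)) ∷ fresh x∉ (inj ∘ there)

Unique-length-≤ : {xs ys : List A} → Unique xs → xs ⊆ˢ ys → length xs ≤ length ys
Unique-length-≤ [] _ = z≤n
Unique-length-≤ {xs = x ∷ xs} (x∉ ∷ u) xs⊆ys with ys₁ , ys₂ , refl ← ∈-∃++ (xs⊆ys (here refl)) =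
  ≤-trans (s≤s (Unique-length-≤ u xs⊆ys₁++ys₂)) (≤-reflexive (sym (↭-length (shift x ys₁ ys₂))))
  where
  xs⊆ys₁++ys₂ : xs ⊆ˢ ys₁ ++ ys₂
  xs⊆ys₁++ys₂ z∈xs with ∈-++⁻ ys₁ (xs⊆ys (there z∈xs))
  ... | inj₁ z∈ys₁ = ∈-++⁺ˡ z∈ys₁
  ... | inj₂ (here refl) = ⊥-elim (All.lookup x∉ z∈xs refl)
  ... | inj₂ (there z∈ys₂) = ∈-++⁺ʳ ys₁ z∈ys₂

esBound : ℕ → ℕ → ℕ
esBound zero b = 0
esBound (suc a) zero = 0
esBound (suc a) (suc b) = suc (esBound a (suc b) + esBound (suc a) b)

iteratedBound : ℕ → ℕ → ℕ
iteratedBound zero r = r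
iteratedBound (suc s) r = esBound (iteratedBound s r) (iteratedBound s r)

_⊆±_ : List A → List A → Set
p ⊆± q = p ⊆ q ⊎ reverse p ⊆ q

⊆±-resp-⊆ : {p′ p q : List A} → p′ ⊆ p → p ⊆± q → p′ ⊆± q
⊆±-resp-⊆ τ (inj₁ p⊆q) = inj₁ (⊆-trans τ p⊆q)
⊆±-resp-⊆ τ (inj₂ p⊆q) = inj₂ (⊆-trans (reverse⁺ τ) p⊆q)

⊆ˢ-resp-⊆ : {p′ p q : List A} → p′ ⊆ p → p ⊆ˢ q → p′ ⊆ˢ q
⊆ˢ-resp-⊆ τ p⊆q = p⊆q ∘ Any-resp-⊆ τ

module _ (_≟ᴬ_ : DecidableEquality A) where

  open DecMembership _≟ᴬ_ using (_∈?_)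

  filter-∈-⊆ˢ : ∀ {ys} (xs : List A) → filter (_∈? ys) xs ⊆ˢ ys
  filter-∈-⊆ˢ {ys} xs m with _ , z∈ys ← ∈-filter⁻ (_∈? ys) {xs = xs} m = z∈ys

  filter-∉-⊆ˢ : ∀ {x xs ys₁ ys₂} → All (λ z → ¬ x ≡ z) xs → xs ⊆ˢ ys₁ ++ x ∷ ys₂ →
                filter (∁? (_∈? ys₂)) xs ⊆ˢ ys₁
  filter-∉-⊆ˢ {ys₁ = ys₁} {ys₂} x∉ xs⊆ m with z∈xs , z∉ys₂ ← ∈-filter⁻ (∁? (_∈? ys₂)) m
    with ∈-++⁻ ys₁ (xs⊆ z∈xs)
  ... | inj₁ z∈ys₁ = z∈ys₁
  ... | inj₂ (here refl) = ⊥-elim (All.lookup x∉ z∈xs refl)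
  ... | inj₂ (there z∈ys₂) = ⊥-elim (z∉ys₂ z∈ys₂)

  -- A sublist of p that is increasing of length a, or decreasing of length b, w.r.t. the order of q.
  MonotoneSublist : ℕ → ℕ → List A → List A → Set
  MonotoneSublist a b p q = ∃[ p′ ] p′ ⊆ p × (length p′ ≡ a × p′ ⊆ q ⊎ length p′ ≡ b × reverse p′ ⊆ q)

  MonotoneSublist-after : ∀ {a b x rest′ rest} q₁ {q₂} → rest′ ⊆ rest → MonotoneSublist a b rest′ q₂ →
                          MonotoneSublist (suc a) b (x ∷ rest) (q₁ ++ x ∷ q₂)
  MonotoneSublist-after q₁ σ (p′ , τ , inj₁ (len , p′⊆)) =
    _ ∷ p′ , refl ∷ ⊆-trans τ σ , inj₁ (cong suc len , ++⁺ˡ q₁ (refl ∷ p′⊆))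
  MonotoneSublist-after q₁ σ (p′ , τ , inj₂ (len , p′⊆)) =
    p′ , _ ∷ʳ ⊆-trans τ σ , inj₂ (len , ++⁺ˡ q₁ (_ ∷ʳ p′⊆))

  MonotoneSublist-before : ∀ {a b x rest′ rest q₁} q₂ → rest′ ⊆ rest → MonotoneSublist a b rest′ q₁ →
                           MonotoneSublist a (suc b) (x ∷ rest) (q₁ ++ x ∷ q₂)
  MonotoneSublist-before q₂ σ (p′ , τ , inj₁ (len , p′⊆)) =
    p′ , _ ∷ʳ ⊆-trans τ σ , inj₁ (len , ++⁺ʳ (_ ∷ q₂) p′⊆)
  MonotoneSublist-before {x = x} {q₁ = q₁} q₂ σ (p′ , τ , inj₂ (len , p′⊆)) =
    x ∷ p′ , refl ∷ ⊆-trans τ σ , inj₂ (cong suc len , subst (_⊆ q₁ ++ x ∷ q₂) (sym (unfold-reverse x p′)) (++⁺ p′⊆ (refl ∷ minimum q₂)))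

  -- Split the letters after the head x of p by their position relative to x in q: the later
  -- ones extend increasing sublists by x in front, the earlier ones decreasing sublists.
  erdosSzekeres : ∀ a b {p q : List A} → Unique p → p ⊆ˢ q → esBound a b ≤ length p →
                  MonotoneSublist a b p q
  erdosSzekeres zero b _ _ _ = [] , minimum _ , inj₁ (refl , minimum _)
  erdosSzekeres (suc a) zero _ _ _ = [] , minimum _ , inj₂ (refl , minimum _)
  erdosSzekeres (suc a) (suc b) {x ∷ rest} (x∉ ∷ u) p⊆q (s≤s bound)
    with q₁ , q₂ , refl ← ∈-∃++ (p⊆q (here refl))
    with +-≤-split _ _ _ _ (≤-trans bound (≤-reflexive (sym (length-filter-∁ (_∈? q₂) rest))))
  ... | inj₁ enough-later = MonotoneSublist-after q₁ (filter-⊆ _ rest)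
          (erdosSzekeres a (suc b) (Unique-filter⁺ (_∈? q₂) u) (filter-∈-⊆ˢ rest) enough-later)
  ... | inj₂ enough-earlier = MonotoneSublist-before q₂ (filter-⊆ _ rest)
          (erdosSzekeres (suc a) b (Unique-filter⁺ (∁? (_∈? q₂)) u) (filter-∉-⊆ˢ x∉ (p⊆q ∘ there)) enough-earlier)

  erdosSzekeres-diagonal : ∀ n {p q : List A} → Unique p → p ⊆ˢ q → esBound n n ≤ length p →
                           ∃[ p′ ] p′ ⊆ p × length p′ ≡ n × p′ ⊆± q
  erdosSzekeres-diagonal n u p⊆q bound with erdosSzekeres n n u p⊆q bound
  ... | p′ , τ , inj₁ (len , p′⊆) = p′ , τ , len , inj₁ p′⊆
  ... | p′ , τ , inj₂ (len , p′⊆) = p′ , τ , len , inj₂ p′⊆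

  commonMonotoneSublist : ∀ (qs : List (List A)) r {p} → Unique p → All (p ⊆ˢ_) qs →
                          iteratedBound (length qs) r ≤ length p →
                          ∃[ p′ ] p′ ⊆ p × length p′ ≡ r × All (p′ ⊆±_) qs
  commonMonotoneSublist [] r {p} _ [] bound = take r p , take-⊆ r p , length-take-≤ r p bound , []
  commonMonotoneSublist (q ∷ qs) r u (p⊆q ∷ p⊆qs) bound
    with p₁ , p₁⊆p , len₁ , p₁⊆±q ← erdosSzekeres-diagonal _ u p⊆q bound
    with p′ , p′⊆p₁ , len′ , p′⊆±qs ← commonMonotoneSublist qs r (Unique-resp-⊆ p₁⊆p u)
           (All.map (⊆ˢ-resp-⊆ p₁⊆p) p⊆qs) (≤-reflexive (sym len₁))
    = p′ , ⊆-trans p′⊆p₁ p₁⊆p , len′ , ⊆±-resp-⊆ p′⊆p₁ p₁⊆±q ∷ p′⊆±qs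

orient : List A → Bool → List A
orient L true = L
orient L false = reverse L

binaryFormation : List Bool → List A → List A
binaryFormation π L = concat (map (orient L) π)

orient-binary : (L : List A) (b : Bool) → orient L b ≡ L ⊎ orient L b ≡ reverse L
orient-binary L true = inj₁ refl
orient-binary L false = inj₂ refl

orient-↭ : (L : List A) (b : Bool) → orient L b ↭ L
orient-↭ L true = ↭-refl
orient-↭ L false = ↭-reverse L

binaryFormation-isFormation : ∀ π {L : Seq} → Unique L →
                              IsFormation (length L) (length π) (binaryFormation π L)
binaryFormation-isFormation π {L} uL =
  map (orient L) π , length-map _ π , refl , L , uL , refl , All-map⁺ (All.universal (orient-↭ L) π)

binaryFormation-isBinary : ∀ π {p : Seq} → Unique p →
                           IsBinaryFormation (length p) (length π) (binaryFormation π p)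
binaryFormation-isBinary π {p} up =
  map (orient p) π , length-map _ π , refl , p , up , refl , All-map⁺ (All.universal (orient-binary p) π)

isBinaryFormation⇒binaryFormation : ∀ {r s x} → IsBinaryFormation r s x →
  ∃₂ λ π p → length π ≡ s × Unique p × length p ≡ r × binaryFormation π p ≡ x
isBinaryFormation⇒binaryFormation (ps , refl , refl , p , up , refl , orientations) =
  let π , eq = word orientations in π , p , trans (sym (length-map _ π)) (cong length eq) , up , refl , cong concat eq
  where
  word : ∀ {p : Seq} {ps} → All (λ q → q ≡ p ⊎ q ≡ reverse p) ps → ∃[ π ] map (orient p) π ≡ ps
  word [] = [] , refl
  word (inj₁ refl ∷ os) = let π , eq = word os in true ∷ π , cong (_ ∷_) eq
  word (inj₂ refl ∷ os) = let π , eq = word os in false ∷ π , cong (_ ∷_) eq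

binarySublist : ∀ {p′ : List A} ps → All (p′ ⊆±_) ps →
                ∃[ π ] length π ≡ length ps × binaryFormation π p′ ⊆ concat ps
binarySublist [] [] = [] , refl , []
binarySublist (q ∷ ps) (p′⊆±q ∷ p′⊆±ps) with π , len , τ ← binarySublist ps p′⊆±ps with p′⊆±q
... | inj₁ p′⊆q = true ∷ π , cong suc len , ++⁺ p′⊆q τ
... | inj₂ p′⊆q = false ∷ π , cong suc len , ++⁺ p′⊆q τ

binaryFormation-mono : ∀ {π′ π : List Bool} {L′ L : List A} → π′ ⊆ π → L′ ⊆ L →
                       binaryFormation π′ L′ ⊆ binaryFormation π L
binaryFormation-mono [] _ = []
binaryFormation-mono {L = L} (b ∷ʳ σ) τ = ++⁺ˡ (orient L b) (binaryFormation-mono σ τ)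
binaryFormation-mono {π = b ∷ _} (refl ∷ σ) τ = ++⁺ (orient-mono b τ) (binaryFormation-mono σ τ)
  where
  orient-mono : ∀ b {L′ L : List A} → L′ ⊆ L → orient L′ b ⊆ orient L b
  orient-mono true τ = τ
  orient-mono false τ = reverse⁺ τ

map-binaryFormation : (g : A → B) (π : List Bool) (L : List A) →
                      map g (binaryFormation π L) ≡ binaryFormation π (map g L)
map-binaryFormation g [] L = refl
map-binaryFormation g (b ∷ π) L =
  trans (map-++ g (orient L b) _) (cong₂ _++_ (map-orient b) (map-binaryFormation g π L))
  where
  map-orient : ∀ b → map g (orient L b) ≡ orient (map g L) b
  map-orient true = refl
  map-orient false = reverse-map g L

filter-binaryFormation : {P : Pred A ℓ} (P? : Decidable P) (π : List Bool) (L : List A) →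
                         filter P? (binaryFormation π L) ≡ binaryFormation π (filter P? L)
filter-binaryFormation P? [] L = refl
filter-binaryFormation P? (b ∷ π) L =
  trans (filter-++ P? (orient L b) _) (cong₂ _++_ (filter-orient b) (filter-binaryFormation P? π L))
  where
  filter-orient : ∀ b → filter P? (orient L b) ≡ orient (filter P? L) b
  filter-orient true = refl
  filter-orient false = filter-reverse P? L

∈-binaryFormation : ∀ π {L : List A} {z} → z ∈ binaryFormation π L → z ∈ L
∈-binaryFormation π {L} z∈ with block , z∈block , block∈ ← ∈-concat⁻′ (map (orient L) π) z∈ =
  ∈-resp-↭ (All.lookup (All-map⁺ (All.universal (orient-↭ L) π)) block∈) z∈block

Contains-⊆ : ∀ {x y u} → y ⊆ x → Contains y u → Contains x u
Contains-⊆ y⊆x (v , v⊆y , occurrence) = v , ⊆-trans v⊆y y⊆x , occurrence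

Contains-map : ∀ {y u} (g h : ℕ → ℕ) → (∀ {z} → z ∈ y → h (g z) ≡ z) → Contains y u → Contains (map g y) u
Contains-map {u = u} g h hg (v , v⊆y , f , inj , fv≡u) = map g v , map⁺ g v⊆y , f ∘ h , inj′ , fhgv≡u
  where
  hg-v : ∀ {z} → z ∈ v → h (g z) ≡ z
  hg-v = hg ∘ Any-resp-⊆ v⊆y
  fhgv≡u : map (f ∘ h) (map g v) ≡ u
  fhgv≡u = trans (sym (map-∘ v)) (trans (map-cong-local (All.tabulate (cong f ∘ hg-v))) fv≡u)
  inj′ : InjectiveOn (f ∘ h) (map g v)
  inj′ a∈ b∈ fha≡fhb with a , a∈v , refl ← ∈-map⁻ g a∈ | b , b∈v , refl ← ∈-map⁻ g b∈ =
    cong g (inj a∈v b∈v (trans (cong f (sym (hg-v a∈v))) (trans fha≡fhb (cong f (hg-v b∈v)))))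

occurrence-letters-≤ : ∀ {v u K} (f : ℕ → ℕ) → InjectiveOn f v → map f v ≡ u →
                       Unique K → K ⊆ˢ v → length K ≤ distinctLetters u
occurrence-letters-≤ {u = u} {K} f inj fv≡u uK K⊆v = begin
  length K                    ≡⟨ sym (length-map f K) ⟩
  length (map f K)            ≤⟨ Unique-length-≤ (Unique-map⁺ f (λ a b → inj (K⊆v a) (K⊆v b)) uK) fK⊆u ⟩
  distinctLetters u           ∎
  where
  open ≤-Reasoning
  fK⊆u : map f K ⊆ˢ deduplicate _≟_ _
  fK⊆u m with a , a∈K , refl ← ∈-map⁻ f m = ∈-deduplicate⁺ _≟_ (subst (f a ∈_) fv≡u (∈-map⁺ f (K⊆v a∈K)))

restrictAlphabet : ∀ π {L u} → Unique L → Contains (binaryFormation π L) u →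
                   ∃[ K ] Unique K × length K ≤ distinctLetters u × Contains (binaryFormation π K) u
restrictAlphabet π {L} uL (v , v⊆ , f , inj , fv≡u) =
  K , Unique-filter⁺ (_∈? v) uL , occurrence-letters-≤ f inj fv≡u (Unique-filter⁺ (_∈? v) uL) K⊆v ,
  v , v⊆πK , f , inj , fv≡u
  where
  open DecMembership _≟_ using (_∈?_)
  K = filter (_∈? v) L
  K⊆v : K ⊆ˢ v
  K⊆v m with _ , z∈v ← ∈-filter⁻ (_∈? v) {xs = L} m = z∈v
  v⊆πK : v ⊆ binaryFormation π K
  v⊆πK = subst₂ _⊆_ (filter-all (_∈? v) (All.tabulate (λ z∈v → z∈v)))
           (filter-binaryFormation (_∈? v) π L) (filter⁺ (_∈? v) (_∈? v) (λ { refl z∈v → z∈v }) v⊆)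

rename : Seq → Seq → ℕ → ℕ
rename (x ∷ xs) (y ∷ ys) z with z ≟ x
... | yes _ = y
... | no _ = rename xs ys z
rename _ _ z = z

rename-head : ∀ x xs y ys → rename (x ∷ xs) (y ∷ ys) x ≡ y
rename-head x xs y ys with x ≟ x
... | yes _ = refl
... | no x≢x = ⊥-elim (x≢x refl)

rename-tail : ∀ {x xs y ys z} → ¬ x ≡ z → rename (x ∷ xs) (y ∷ ys) z ≡ rename xs ys z
rename-tail {x} {z = z} x≢z with z ≟ x
... | yes z≡x = ⊥-elim (x≢z (sym z≡x))
... | no _ = refl

map-rename : ∀ {xs ys} → Unique xs → length xs ≡ length ys → map (rename xs ys) xs ≡ ys
map-rename {[]} {[]} _ _ = refl
map-rename {x ∷ xs} {y ∷ ys} (x∉ ∷ u) len = cong₂ _∷_ (rename-head x xs y ys)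
  (trans (map-cong-local (All.map rename-tail x∉)) (map-rename u (cong pred len)))

rename-∈ : ∀ {xs ys z} → length xs ≡ length ys → z ∈ xs → rename xs ys z ∈ ys
rename-∈ {x ∷ xs} {y ∷ ys} {z} len z∈ with z ≟ x | z∈
... | yes _ | _ = here refl
... | no z≢x | here z≡x = ⊥-elim (z≢x z≡x)
... | no _ | there z∈xs = there (rename-∈ (cong pred len) z∈xs)

rename-inverse : ∀ {xs ys z} → Unique ys → length xs ≡ length ys → z ∈ xs → rename ys xs (rename xs ys z) ≡ z
rename-inverse {x ∷ xs} {y ∷ ys} {z} _ _ _ with z ≟ x
rename-inverse {x ∷ xs} {y ∷ ys} {z} _ _ _ | yes z≡x = trans (rename-head y ys x xs) (sym z≡x)
rename-inverse {x ∷ xs} {y ∷ ys} {z} _ _ (here z≡x) | no z≢x = ⊥-elim (z≢x z≡x)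
rename-inverse {x ∷ xs} {y ∷ ys} {z} (y∉ ∷ u) len (there z∈xs) | no _ =
  trans (rename-tail (All.lookup y∉ (rename-∈ (cong pred len) z∈xs)))
        (rename-inverse u (cong pred len) z∈xs)

renameAlphabet : ∀ π {K K′ u} → Unique K → Unique K′ → length K ≡ length K′ →
                 Contains (binaryFormation π K) u → Contains (binaryFormation π K′) u
renameAlphabet π {K} {K′} uK uK′ len occurrence =
  subst (λ y → Contains y _) (trans (map-binaryFormation g π K) (cong (binaryFormation π) (map-rename uK len)))
    (Contains-map g (rename K′ K) (rename-inverse uK′ len ∘ ∈-binaryFormation π) occurrence)
  where
  g = rename K K′

binarySubformation : ∀ {r s x} → IsFormation (iteratedBound s r) s x →
                     ∃[ y ] IsBinaryFormation r s y × y ⊆ x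
binarySubformation {r} (ps , refl , refl , L , uL , lenL , perms)
  with p′ , p′⊆L , lenp′ , p′⊆±ps ← commonMonotoneSublist _≟_ ps r uL
         (All.map (⊆-reflexive-↭ ∘ ↭-sym) perms) (≤-reflexive (sym lenL))
  with π , lenπ , πp′⊆ ← binarySublist ps p′⊆±ps
  = binaryFormation π p′ ,
    subst₂ (λ r s → IsBinaryFormation r s _) lenp′ lenπ (binaryFormation-isBinary π (Unique-resp-⊆ p′⊆L uL)) ,
    πp′⊆

binaryContainment⇒fwWitness : ∀ {u r s} → (∀ x → IsBinaryFormation r s x → Contains x u) → FwWitness u s
binaryContainment⇒fwWitness {r = r} {s} binary-contains =
  iteratedBound s r , λ x formation →
    let y , binary , y⊆x = binarySubformation formation in Contains-⊆ y⊆x (binary-contains y binary)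

prefixFormation : ∀ r′ {w} (π : List Bool) → w ≤ length π →
                  IsFormation r′ w (binaryFormation (take w π) (upTo r′))
prefixFormation r′ {w} π w≤|π| =
  subst₂ (λ r″ w′ → IsFormation r″ w′ (binaryFormation (take w π) (upTo r′)))
    (length-upTo r′) (length-take-≤ w π w≤|π|) (binaryFormation-isFormation (take w π) (upTo⁺ r′))

fwWitness⇒binaryContainment : ∀ {u r w s} → distinctLetters u ≤ r → FwWitness u w → w ≤ s →
                              ∀ x → IsBinaryFormation r s x → Contains x u
fwWitness⇒binaryContainment {w = w} letters≤r (r′ , formations-contain) w≤s x binary
  with π , p , refl , up , refl , refl ← isBinaryFormation⇒binaryFormation binary
  with K , uK , |K|≤ , occurrence ← restrictAlphabet (take w π) (upTo⁺ r′)
                                      (formations-contain _ (prefixFormation r′ π w≤s))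
  = Contains-⊆ (binaryFormation-mono (take-⊆ w π) (take-⊆ (length K) p))
      (renameAlphabet (take w π) uK (Unique-take⁺ (length K) up)
        (sym (length-take-≤ _ p (≤-trans |K|≤ letters≤r))) occurrence)

corollary2p2 : (u : Seq) (r : ℕ) → distinctLetters u ≡ r →
    (w : ℕ) → IsFormationWidth u w →
    (s : ℕ) → 1 ≤ s →
    ((∀ x → IsBinaryFormation r s x → Contains x u) ⇔ w ≤ s)
corollary2p2 u r letters≡r w (witness , minimal) s _ = mk⇔
  (λ binary-contains → minimal s (binaryContainment⇒fwWitness binary-contains))
  (λ w≤s → fwWitness⇒binaryContainment (≤-reflexive letters≡r) witness w≤s)
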